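{- Let $q,k,\ell,t$ be positive integers with $\ell\le k$ and $t$ dividing $k$. Then \[\mathcal{E}(q,tk,t\ell)\geq\frac{k^{t-1}}{t}\,\mathcal{E}(q,k,\ell)^t.\]
   Context: Let $q,k,\ell$ be positive integers with $\ell\le k$. A colouring of $n$ eBugs is an $n$-tuple of words $w_1,\dots,w_n\in\mathbb{Z}_q^k$ (positions read modulo $k$). It is $\ell$-valid if the $nk$ cyclic windows $(w_j(i),w_j(i+1),\dots,w_j(i+\ell-1))\in\mathbb{Z}_q^\ell$ (positions modulo $k$), for $1\le j\le n$ and $0\le i<k$, are pairwise distinct. The eBug number $\mathcal{E}(q,k,\ell)$ is the maximum $n$ for which an $\ell$-valid colouring of $n$ eBugs exists. -}

module Defs where

open import Data.Nat using (ℕ; zero; suc; _+_; _*_; _≤_; NonZero)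
open import Data.Nat.DivMod using (_%_)
open import Data.Fin using (Fin; toℕ; fromℕ<)
open import Data.Nat.DivMod using (m%n<n)
open import Data.Product using (_×_; _,_; ∃)
open import Relation.Binary.PropositionalEquality using (_≡_)

Word : ℕ → ℕ → Set
Word q k = Fin k → Fin q

shiftPos : (k : ℕ) → .{{NonZero k}} → Fin k → ℕ → Fin k
shiftPos k i j = fromℕ< (m%n<n (toℕ i + j) k)

window : ∀ {q} (k ℓ : ℕ) → .{{NonZero k}} → Word q k → Fin k → Fin ℓ → Fin q
window k ℓ w i m = w (shiftPos k i (toℕ m))

-- A colouring of n eBugs is ℓ-valid if the nk windows are pairwise distinct,
-- i.e. the map (j , i) ↦ window of w_j at i is injective (windows compared
-- pointwise as elements of ℤ_q^ℓ).
Valid : (q k ℓ n : ℕ) → .{{NonZero k}} → (Fin n → Word q k) → Set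
Valid q k ℓ n ws =
  ∀ (j₁ j₂ : Fin n) (i₁ i₂ : Fin k) →
  (∀ m → window k ℓ (ws j₁) i₁ m ≡ window k ℓ (ws j₂) i₂ m) →
  (j₁ ≡ j₂) × (i₁ ≡ i₂)

HasValidColouring : (q k ℓ n : ℕ) → .{{NonZero k}} → Set
HasValidColouring q k ℓ n = ∃ λ (ws : Fin n → Word q k) → Valid q k ℓ n ws

IsEBugNumber : (q k ℓ E : ℕ) → .{{NonZero k}} → Set
IsEBugNumber q k ℓ E =
  HasValidColouring q k ℓ E × (∀ n → HasValidColouring q k ℓ n → n ≤ E)

module Submission where

-- Fix an optimal ℓ-valid colouring u₁, …, u_E of words of length k, and write k = m t.  A new
-- word of length t k interleaves t of the old words (repetitions allowed), the r-th one rotated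
-- by an offset S r: its letter at position n is letter S (n mod t) + ⌊n / t⌋ of word number
-- n mod t.  A window of length t ℓ then splits into t windows of length ℓ of the old words, so
-- by validity of the old colouring two equal windows determine, modulo k, the t "source"
-- positions S ((p + d) mod t) + ⌊(p + d) / t⌋.  Summing them over d < t gives ∑ S + p, so
-- requiring k ∣ ∑ S recovers p mod k; requiring S 0 < m then recovers ⌊p / k⌋, and with p
-- known every word and offset is recovered.  For t ≥ 2 there are E^t choices of words and
-- m k^(t-2) admissible offset vectors, so E′ ≥ E^t m k^(t-2), and t m k^(t-2) = k^(t-1).

open import Defs
open import Data.Nat
open import Data.Nat.Properties
open import Data.Nat.DivMod
open import Data.Nat.Divisibility using (_∣_; divides; ∣-refl; _∣0; n∣m*n; m%n≡0⇒n∣m)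
open import Data.Nat.Tactic.RingSolver using (solve-∀)
open import Algebra.Properties.CommutativeSemigroup +-commutativeSemigroup
  using (x∙yz≈y∙xz; x∙yz≈y∙zx; x∙yz≈xz∙y; xy∙z≈x∙zy; xy∙z≈xz∙y; xy∙z≈zx∙y)
open import Data.Fin as Fin using (Fin; toℕ; fromℕ<; combine; remQuot; finToFun; funToFin)
open import Data.Fin.Properties
  using (toℕ-fromℕ<; toℕ-injective; toℕ<n; fromℕ<-cong; combine-remQuot; funToFin-finToFin)
open import Data.Product using (_×_; _,_; ∃; proj₁; proj₂; uncurry)
open import Function using (_∘_)
open import Relation.Binary.PropositionalEquality
open import Relation.Nullary using (contradiction)

open ≡-Reasoning

-- Modular arithmetic

[m%d+n]%d≡[m+n]%d : ∀ m n d .{{_ : NonZero d}} → (m % d + n) % d ≡ (m + n) % d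
[m%d+n]%d≡[m+n]%d m n d = begin
  (m % d + n) % d         ≡⟨ %-distribˡ-+ (m % d) n d ⟩
  (m % d % d + n % d) % d ≡⟨ cong (λ x → (x + n % d) % d) (m%n%n≡m%n m d) ⟩
  (m % d + n % d) % d     ≡⟨ %-distribˡ-+ m n d ⟨
  (m + n) % d             ∎

[m+n%d]%d≡[m+n]%d : ∀ m n d .{{_ : NonZero d}} → (m + n % d) % d ≡ (m + n) % d
[m+n%d]%d≡[m+n]%d m n d = begin
  (m + n % d) % d ≡⟨ cong (_% d) (+-comm m (n % d)) ⟩
  (n % d + m) % d ≡⟨ [m%d+n]%d≡[m+n]%d n m d ⟩
  (n + m) % d     ≡⟨ cong (_% d) (+-comm n m) ⟩
  (m + n) % d     ∎

neg% : (n d : ℕ) .{{_ : NonZero d}} → ℕ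
neg% n d = (d ∸ n % d) % d

[neg%n+n]%d≡0 : ∀ n d .{{_ : NonZero d}} → (neg% n d + n) % d ≡ 0
[neg%n+n]%d≡0 n d = begin
  ((d ∸ n % d) % d + n) % d ≡⟨ [m%d+n]%d≡[m+n]%d (d ∸ n % d) n d ⟩
  (d ∸ n % d + n) % d       ≡⟨ [m+n%d]%d≡[m+n]%d (d ∸ n % d) n d ⟨
  (d ∸ n % d + n % d) % d   ≡⟨ cong (_% d) (m∸n+n≡m (m%n≤n n d)) ⟩
  d % d                     ≡⟨ n%n≡0 d ⟩
  0                         ∎

[m+[neg%n+n]]%d≡m%d : ∀ m n d .{{_ : NonZero d}} → (m + (neg% n d + n)) % d ≡ m % d
[m+[neg%n+n]]%d≡m%d m n d = begin
  (m + (neg% n d + n)) % d     ≡⟨ [m+n%d]%d≡[m+n]%d m _ d ⟨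
  (m + (neg% n d + n) % d) % d ≡⟨ cong (λ x → (m + x) % d) ([neg%n+n]%d≡0 n d) ⟩
  (m + 0) % d                  ≡⟨ cong (_% d) (+-identityʳ m) ⟩
  m % d                        ∎

+-cancelʳ-% : ∀ {a b} o d .{{_ : NonZero d}} → a < d → b < d → (a + o) % d ≡ (b + o) % d → a ≡ b
+-cancelʳ-% {a} {b} o d a<d b<d eq = begin
  a                            ≡⟨ undo a<d ⟨
  ((a + o) % d + neg% o d) % d ≡⟨ cong (λ x → (x + neg% o d) % d) eq ⟩
  ((b + o) % d + neg% o d) % d ≡⟨ undo b<d ⟩
  b                            ∎
  where
  undo : ∀ {x} → x < d → ((x + o) % d + neg% o d) % d ≡ x
  undo {x} x<d = begin
    ((x + o) % d + neg% o d) % d ≡⟨ [m%d+n]%d≡[m+n]%d (x + o) (neg% o d) d ⟩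
    (x + o + neg% o d) % d       ≡⟨ cong (_% d) (xy∙z≈x∙zy x o (neg% o d)) ⟩
    (x + (neg% o d + o)) % d     ≡⟨ [m+[neg%n+n]]%d≡m%d x o d ⟩
    x % d                        ≡⟨ m<n⇒m%n≡m x<d ⟩
    x                            ∎

reach-residue : ∀ {t} .{{_ : NonZero t}} p {r} → r < t → ∃ λ d → d < t × (p + d) % t ≡ r
reach-residue {t} p {r} r<t = (r + neg% p t) % t , m%n<n _ t , (begin
  (p + (r + neg% p t) % t) % t ≡⟨ [m+n%d]%d≡[m+n]%d p _ t ⟩
  (p + (r + neg% p t)) % t     ≡⟨ cong (_% t) (x∙yz≈y∙zx p r (neg% p t)) ⟩
  (r + (neg% p t + p)) % t     ≡⟨ [m+[neg%n+n]]%d≡m%d r p t ⟩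
  r % t                        ≡⟨ m<n⇒m%n≡m r<t ⟩
  r                            ∎)

[m+kn]/n≡m/n+k : ∀ m k n .{{_ : NonZero n}} → (m + k * n) / n ≡ m / n + k
[m+kn]/n≡m/n+k m k n = trans (+-distrib-/-∣ʳ m (n∣m*n k)) (cong (m / n +_) (m*n/n≡m k n))

a<n⇒b<o⇒a+b*n<o*n : ∀ {a b n o} → a < n → b < o → a + b * n < o * n
a<n⇒b<o⇒a+b*n<o*n {b = b} {n} a<n b<o = ≤-trans (+-monoˡ-< (b * n) a<n) (*-monoˡ-≤ n b<o)

quotient-unique : ∀ {m a a′} z z′ .{{_ : NonZero m}} → a < m → a′ < m → a + z * m ≡ a′ + z′ * m → z ≡ z′
quotient-unique {m} {a} {a′} z z′ a<m a′<m eq = begin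
  z                 ≡⟨ quotient a<m ⟨
  (a + z * m) / m   ≡⟨ cong (_/ m) eq ⟩
  (a′ + z′ * m) / m ≡⟨ quotient a′<m ⟩
  z′                ∎
  where
  quotient : ∀ {x y} → x < m → (x + y * m) / m ≡ y
  quotient {x} {y} x<m = trans ([m+kn]/n≡m/n+k x y m) (cong (_+ y) (m<n⇒m/n≡0 x<m))

-- Finite sums

∑< : ℕ → (ℕ → ℕ) → ℕ
∑< zero    f = 0
∑< (suc n) f = f 0 + ∑< n (f ∘ suc)

syntax ∑< n (λ i → e) = ∑[ i < n ] e

∑<-cong : ∀ n {f g} → (∀ i → i < n → f i ≡ g i) → ∑< n f ≡ ∑< n g
∑<-cong zero    eq = refl
∑<-cong (suc n) eq = cong₂ _+_ (eq 0 z<s) (∑<-cong n (λ i i<n → eq (suc i) (s<s i<n)))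

∑<-cong-% : ∀ n {f g} d .{{_ : NonZero d}} → (∀ i → i < n → f i % d ≡ g i % d) → ∑< n f % d ≡ ∑< n g % d
∑<-cong-% zero    d eq = refl
∑<-cong-% (suc n) {f} {g} d eq = begin
  (f 0 + ∑< n (f ∘ suc)) % d             ≡⟨ %-distribˡ-+ (f 0) _ d ⟩
  (f 0 % d + ∑< n (f ∘ suc) % d) % d     ≡⟨ cong₂ (λ x y → (x + y) % d) (eq 0 z<s) tail ⟩
  (g 0 % d + ∑< n (g ∘ suc) % d) % d     ≡⟨ %-distribˡ-+ (g 0) _ d ⟨
  (g 0 + ∑< n (g ∘ suc)) % d             ∎
  where tail = ∑<-cong-% n d (λ i i<n → eq (suc i) (s<s i<n))

∑<-shift : ∀ n f → ∑< n (f ∘ suc) + f 0 ≡ ∑< n f + f n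
∑<-shift zero    f = refl
∑<-shift (suc n) f = begin
  (f 1 + ∑< n (f ∘ suc ∘ suc)) + f 0 ≡⟨ cong (_+ f 0) (+-comm (f 1) _) ⟩
  (∑< n (f ∘ suc ∘ suc) + f 1) + f 0 ≡⟨ cong (_+ f 0) (∑<-shift n (f ∘ suc)) ⟩
  (∑< n (f ∘ suc) + f (suc n)) + f 0 ≡⟨ xy∙z≈zx∙y _ (f (suc n)) (f 0) ⟩
  (f 0 + ∑< n (f ∘ suc)) + f (suc n) ∎

source : (t : ℕ) .{{_ : NonZero t}} → (ℕ → ℕ) → ℕ → ℕ
source t S n = S (n % t) + n / t

module _ (t : ℕ) .{{_ : NonZero t}} (S : ℕ → ℕ) where

  source-+*t : ∀ n c → source t S (n + c * t) ≡ source t S n + c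
  source-+*t n c = begin
    S ((n + c * t) % t) + (n + c * t) / t ≡⟨ cong₂ (λ r x → S r + x) ([m+kn]%n≡m%n n c t) ([m+kn]/n≡m/n+k n c t) ⟩
    S (n % t) + (n / t + c)               ≡⟨ +-assoc (S (n % t)) (n / t) c ⟨
    source t S n + c                      ∎

  source-+t : ∀ n → source t S (n + t) ≡ suc (source t S n)
  source-+t n = begin
    S ((n + t) % t) + (n + t) / t ≡⟨ cong₂ (λ r x → S r + x) ([m+n]%n≡m%n n t) (+-distrib-/-∣ʳ n ∣-refl) ⟩
    S (n % t) + (n / t + t / t)   ≡⟨ cong (λ x → S (n % t) + (n / t + x)) (n/n≡1 t) ⟩
    S (n % t) + (n / t + 1)       ≡⟨ cong (S (n % t) +_) (+-comm (n / t) 1) ⟩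
    S (n % t) + suc (n / t)       ≡⟨ +-suc (S (n % t)) (n / t) ⟩
    suc (source t S n)            ∎

  -- Over a full period the offsets are each read once and the quotients sum to p (Hermite's identity).
  ∑-source : ∀ p → ∑[ d < t ] source t S (p + d) ≡ ∑[ r < t ] S r + p
  ∑-source zero = begin
    ∑[ d < t ] source t S d ≡⟨ ∑<-cong t (λ d d<t → cong₂ (λ r x → S r + x) (m<n⇒m%n≡m d<t) (m<n⇒m/n≡0 d<t)) ⟩
    ∑[ d < t ] (S d + 0)    ≡⟨ ∑<-cong t (λ d _ → +-identityʳ (S d)) ⟩
    ∑< t S                  ≡⟨ +-identityʳ (∑< t S) ⟨
    ∑< t S + 0              ∎
  ∑-source (suc p) = +-cancelʳ-≡ (h 0) _ _ (begin
    ∑[ d < t ] source t S (suc p + d) + h 0 ≡⟨ cong (_+ h 0) (∑<-cong t (λ d _ → sym (cong (source t S) (+-suc p d)))) ⟩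
    ∑< t (h ∘ suc) + h 0                    ≡⟨ ∑<-shift t h ⟩
    ∑< t h + h t                            ≡⟨ cong (∑< t h +_) (source-+t p) ⟩
    ∑< t h + suc (source t S p)             ≡⟨ cong (λ x → ∑< t h + suc (source t S x)) (+-identityʳ p) ⟨
    ∑< t h + suc (h 0)                      ≡⟨ +-suc (∑< t h) (h 0) ⟩
    suc (∑< t h + h 0)                      ≡⟨ cong (λ x → suc (x + h 0)) (∑-source p) ⟩
    suc (∑< t S + p + h 0)                  ≡⟨ cong (_+ h 0) (+-suc (∑< t S) p) ⟨
    ∑< t S + suc p + h 0                    ∎)
    where
    h : ℕ → ℕ
    h d = source t S (p + d)

  ∑-source-% : ∀ {k} .{{_ : NonZero k}} → k ∣ ∑< t S → ∀ p → (∑[ d < t ] source t S (p + d)) % k ≡ p % k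
  ∑-source-% k∣∑S p = trans (cong (_% _) (∑-source p)) (%-remove-+ˡ p k∣∑S)

record Offsets (t m k : ℕ) (S : ℕ → ℕ) : Set where
  field
    offset<k   : ∀ r → r < t → S r < k
    offset₀<m  : S 0 < m
    k∣∑offsets : k ∣ ∑< t S

open Offsets

module Determination {t m k : ℕ} .{{_ : NonZero t}} .{{_ : NonZero k}} (k≡m*t : k ≡ m * t)
  {S S′ : ℕ → ℕ} (O : Offsets t m k S) (O′ : Offsets t m k S′)
  {p p′ : ℕ} (p<tk : p < t * k) (p′<tk : p′ < t * k)
  (agree : ∀ d → d < t → source t S (p + d) % k ≡ source t S′ (p′ + d) % k) where

  instance
    m≢0 : NonZero m
    m≢0 = >-nonZero (≤-<-trans z≤n (offset₀<m O))

  p≡p′[mod-k] : p % k ≡ p′ % k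
  p≡p′[mod-k] = begin
    p % k                                  ≡⟨ ∑-source-% t S (k∣∑offsets O) p ⟨
    (∑[ d < t ] source t S (p + d)) % k    ≡⟨ ∑<-cong-% t k agree ⟩
    (∑[ d < t ] source t S′ (p′ + d)) % k  ≡⟨ ∑-source-% t S′ (k∣∑offsets O′) p′ ⟩
    p′ % k                                 ∎

  residues-agree : ∀ d → (p + d) % t ≡ (p′ + d) % t
  residues-agree d = begin
    (p + d) % t               ≡⟨ via-k p ⟩
    (p % k + d) % k % t       ≡⟨ cong (λ x → (x + d) % k % t) p≡p′[mod-k] ⟩
    (p′ % k + d) % k % t      ≡⟨ via-k p′ ⟨
    (p′ + d) % t              ∎
    where
    via-k : ∀ x → (x + d) % t ≡ (x % k + d) % k % t
    via-k x = begin
      (x + d) % t         ≡⟨ m∣n⇒o%n%m≡o%m t k (x + d) (divides m k≡m*t) ⟨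
      (x + d) % k % t     ≡⟨ cong (_% t) ([m%d+n]%d≡[m+n]%d x d k) ⟨
      (x % k + d) % k % t ∎

  /t-split : ∀ x d → (x + d) / t ≡ (x % k + d) / t + x / k * m
  /t-split x d = begin
    (x + d) / t                               ≡⟨ cong (λ y → (y + d) / t) (m≡m%n+[m/n]*n x k) ⟩
    (x % k + x / k * k + d) / t               ≡⟨ cong (λ y → (x % k + x / k * y + d) / t) k≡m*t ⟩
    (x % k + x / k * (m * t) + d) / t         ≡⟨ cong (_/ t) (xy∙z≈xz∙y (x % k) _ d) ⟩
    (x % k + d + x / k * (m * t)) / t         ≡⟨ cong (λ y → (x % k + d + y) / t) (*-assoc (x / k) m t) ⟨
    (x % k + d + x / k * m * t) / t           ≡⟨ [m+kn]/n≡m/n+k (x % k + d) (x / k * m) t ⟩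
    (x % k + d) / t + x / k * m               ∎

  -- The block index p / k is read off the residue-0 offset, which is smaller than m.
  p/k≡p′/k : p / k ≡ p′ / k
  p/k≡p′/k with reach-residue p (>-nonZero⁻¹ t)
  ... | d₀ , d₀<t , d₀≡ = quotient-unique (p / k) (p′ / k) (offset₀<m O) (offset₀<m O′)
    (+-cancelʳ-% X k (bound O p<tk) (bound O′ p′<tk) (begin
      (S 0 + p / k * m + X) % k                   ≡⟨ cong (_% k) (split S p d₀≡) ⟨
      source t S (p + d₀) % k                     ≡⟨ agree d₀ d₀<t ⟩
      source t S′ (p′ + d₀) % k                   ≡⟨ cong (_% k) (split S′ p′ (trans (sym (residues-agree d₀)) d₀≡)) ⟩
      (S′ 0 + p′ / k * m + (p′ % k + d₀) / t) % k ≡⟨ cong (λ y → (S′ 0 + p′ / k * m + (y + d₀) / t) % k) p≡p′[mod-k] ⟨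
      (S′ 0 + p′ / k * m + X) % k                 ∎))
    where
    X = (p % k + d₀) / t
    split : ∀ T x → (x + d₀) % t ≡ 0 → source t T (x + d₀) ≡ T 0 + x / k * m + (x % k + d₀) / t
    split T x r≡0 = begin
      T ((x + d₀) % t) + (x + d₀) / t      ≡⟨ cong₂ (λ r y → T r + y) r≡0 (/t-split x d₀) ⟩
      T 0 + ((x % k + d₀) / t + x / k * m) ≡⟨ x∙yz≈xz∙y (T 0) _ _ ⟩
      T 0 + x / k * m + (x % k + d₀) / t   ∎
    bound : ∀ {T x} → Offsets t m k T → x < t * k → T 0 + x / k * m < k
    bound {T} {x} OT x<tk = subst (T 0 + x / k * m <_) (trans (*-comm t m) (sym k≡m*t))
      (a<n⇒b<o⇒a+b*n<o*n {o = t} (offset₀<m OT) (m<n*o⇒m/o<n x<tk))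

  p≡p′ : p ≡ p′
  p≡p′ = begin
    p                   ≡⟨ m≡m%n+[m/n]*n p k ⟩
    p % k + p / k * k   ≡⟨ cong₂ (λ x y → x + y * k) p≡p′[mod-k] p/k≡p′/k ⟩
    p′ % k + p′ / k * k ≡⟨ m≡m%n+[m/n]*n p′ k ⟨
    p′                  ∎

  offsets-agree : ∀ r → r < t → S r ≡ S′ r
  offsets-agree r r<t with reach-residue p r<t
  ... | d , d<t , d≡ = +-cancelʳ-% ((p + d) / t) k (offset<k O r r<t) (offset<k O′ r r<t) (begin
    (S r + (p + d) / t) % k   ≡⟨ cong (λ x → (S x + (p + d) / t) % k) d≡ ⟨
    source t S (p + d) % k    ≡⟨ agree d d<t ⟩
    source t S′ (p′ + d) % k  ≡⟨ cong (λ x → source t S′ (x + d) % k) p≡p′ ⟨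
    source t S′ (p + d) % k   ≡⟨ cong (λ x → (S′ x + (p + d) / t) % k) d≡ ⟩
    (S′ r + (p + d) / t) % k  ∎)

module Interleaving {q k ℓ t m E : ℕ} .{{_ : NonZero k}} .{{_ : NonZero t}} (k≡m*t : k ≡ m * t)
  (us : Fin E → Word q k) (valid : Valid q k ℓ E us) where

  instance
    tk≢0 : NonZero (t * k)
    tk≢0 = m*n≢0 t k

  record Pattern : Set where
    field
      word    : ℕ → Fin E
      offset  : ℕ → ℕ
      offsets : Offsets t m k offset

  open Pattern

  _≈_ : Pattern → Pattern → Set
  P ≈ P′ = (∀ r → r < t → word P r ≡ word P′ r) × (∀ r → r < t → offset P r ≡ offset P′ r)

  at : Word q k → ℕ → Fin q
  at w n = w (n mod k)

  at-cong : ∀ w {a b} → a % k ≡ b % k → at w a ≡ at w b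
  at-cong w {a} {b} eq = cong w (fromℕ<-cong _ _ eq (m%n<n a k) (m%n<n b k))

  mod⇒% : ∀ {x y} → x mod k ≡ y mod k → x % k ≡ y % k
  mod⇒% eq = trans (sym (toℕ-fromℕ< _)) (trans (cong toℕ eq) (toℕ-fromℕ< _))

  letter : Pattern → ℕ → Fin q
  letter P n = at (us (word P (n % t))) (source t (offset P) n)

  interleave : Pattern → Word q (t * k)
  interleave P i = letter P (toℕ i)

  letter-+*t : ∀ P n c → letter P (n + c * t) ≡ at (us (word P (n % t))) (source t (offset P) n + c)
  letter-+*t P n c = cong₂ (λ r x → at (us (word P r)) x) ([m+kn]%n≡m%n n c t) (source-+*t t (offset P) n c)

  letter-+*tk : ∀ P n c → letter P (n + c * (t * k)) ≡ letter P n
  letter-+*tk P n c = begin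
    letter P (n + c * (t * k))                               ≡⟨ cong (λ x → letter P (n + x)) c*tk≡ck*t ⟩
    letter P (n + c * k * t)                                 ≡⟨ letter-+*t P n (c * k) ⟩
    at (us (word P (n % t))) (source t (offset P) n + c * k) ≡⟨ at-cong (us (word P (n % t))) ([m+kn]%n≡m%n _ c k) ⟩
    letter P n                                               ∎
    where
    c*tk≡ck*t : c * (t * k) ≡ c * k * t
    c*tk≡ck*t = trans (cong (c *_) (*-comm t k)) (sym (*-assoc c k t))

  window-interleave : ∀ P (i : Fin (t * k)) (c : Fin (t * ℓ)) →
    window (t * k) (t * ℓ) (interleave P) i c ≡ letter P (toℕ i + toℕ c)
  window-interleave P i c = begin
    letter P (toℕ ((n mod (t * k))))                ≡⟨ cong (letter P) (toℕ-fromℕ< _) ⟩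
    letter P (n % (t * k))                          ≡⟨ letter-+*tk P _ (n / (t * k)) ⟨
    letter P (n % (t * k) + n / (t * k) * (t * k))  ≡⟨ cong (letter P) (m≡m%n+[m/n]*n n (t * k)) ⟨
    letter P n                                      ∎
    where n = toℕ i + toℕ c

  -- Letters c·t apart in the interleaving are consecutive letters of one of the original words.
  window-source : ∀ P n (c : Fin ℓ) →
    window k ℓ (us (word P (n % t))) (source t (offset P) n mod k) c ≡ letter P (n + toℕ c * t)
  window-source P n c = begin
    at w (toℕ (s mod k) + toℕ c) ≡⟨ at-cong w (trans (cong (λ x → (x + toℕ c) % k) (toℕ-fromℕ< _)) ([m%d+n]%d≡[m+n]%d s (toℕ c) k)) ⟩
    at w (s + toℕ c)             ≡⟨ letter-+*t P n (toℕ c) ⟨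
    letter P (n + toℕ c * t)     ∎
    where
    w = us (word P (n % t))
    s = source t (offset P) n

  interleave-injective : ∀ P P′ i i′ →
    (∀ c → window (t * k) (t * ℓ) (interleave P) i c ≡ window (t * k) (t * ℓ) (interleave P′) i′ c) →
    P ≈ P′ × i ≡ i′
  interleave-injective P P′ i i′ same = (words-agree , offsets-agree) , toℕ-injective p≡p′
    where
    p = toℕ i
    p′ = toℕ i′

    letters-agree : ∀ c → c < t * ℓ → letter P (p + c) ≡ letter P′ (p′ + c)
    letters-agree c c<tℓ = begin
      letter P (p + c)                              ≡⟨ cong (λ x → letter P (p + x)) (toℕ-fromℕ< c<tℓ) ⟨
      letter P (p + toℕ (fromℕ< c<tℓ))              ≡⟨ window-interleave P i _ ⟨
      window _ _ (interleave P) i (fromℕ< c<tℓ)     ≡⟨ same (fromℕ< c<tℓ) ⟩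
      window _ _ (interleave P′) i′ (fromℕ< c<tℓ)   ≡⟨ window-interleave P′ i′ _ ⟩
      letter P′ (p′ + toℕ (fromℕ< c<tℓ))            ≡⟨ cong (λ x → letter P′ (p′ + x)) (toℕ-fromℕ< c<tℓ) ⟩
      letter P′ (p′ + c)                            ∎

    sources-agree : ∀ d → d < t →
      (word P ((p + d) % t) ≡ word P′ ((p′ + d) % t)) ×
      (source t (offset P) (p + d) mod k ≡ source t (offset P′) (p′ + d) mod k)
    sources-agree d d<t = valid _ _ _ _ λ c → begin
      _                                ≡⟨ window-source P (p + d) c ⟩
      letter P (p + d + toℕ c * t)     ≡⟨ cong (letter P) (+-assoc p d _) ⟩
      letter P (p + (d + toℕ c * t))   ≡⟨ letters-agree _ (subst (d + toℕ c * t <_) (*-comm ℓ t)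
                                            (a<n⇒b<o⇒a+b*n<o*n d<t (toℕ<n c))) ⟩
      letter P′ (p′ + (d + toℕ c * t)) ≡⟨ cong (letter P′) (+-assoc p′ d _) ⟨
      letter P′ (p′ + d + toℕ c * t)   ≡⟨ window-source P′ (p′ + d) c ⟨
      _                                ∎

    open Determination {m = m} k≡m*t (offsets P) (offsets P′) (toℕ<n i) (toℕ<n i′)
      (λ d d<t → mod⇒% (proj₂ (sources-agree d d<t)))

    words-agree : ∀ r → r < t → word P r ≡ word P′ r
    words-agree r r<t with reach-residue p r<t
    ... | d , d<t , d≡ = begin
      word P r                 ≡⟨ cong (word P) d≡ ⟨
      word P ((p + d) % t)     ≡⟨ proj₁ (sources-agree d d<t) ⟩
      word P′ ((p′ + d) % t)   ≡⟨ cong (word P′) (trans (sym (residues-agree d)) d≡) ⟩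
      word P′ r                ∎

  colouring : ∀ {N} (P : Fin N → Pattern) → (∀ j j′ → P j ≈ P j′ → j ≡ j′) →
    HasValidColouring q (t * k) (t * ℓ) N
  colouring P P-injective = interleave ∘ P , λ j j′ i i′ same →
    let (P≈P′ , i≡i′) = interleave-injective (P j) (P j′) i i′ same in P-injective j j′ P≈P′ , i≡i′

-- Counting the admissible patterns

extend : ∀ {n} → (Fin n → ℕ) → ℕ → ℕ
extend {zero}  f _       = 0
extend {suc n} f zero    = f Fin.zero
extend {suc n} f (suc r) = extend (f ∘ Fin.suc) r

extend-toℕ : ∀ {n} (f : Fin n → ℕ) i → extend f (toℕ i) ≡ f i
extend-toℕ f Fin.zero    = refl
extend-toℕ f (Fin.suc i) = extend-toℕ (f ∘ Fin.suc) i

extend-< : ∀ {n b} (f : Fin n → ℕ) → 0 < b → (∀ i → f i < b) → ∀ r → extend f r < b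
extend-< {zero}  f 0<b f<b r       = 0<b
extend-< {suc n} f 0<b f<b zero    = f<b Fin.zero
extend-< {suc n} f 0<b f<b (suc r) = extend-< (f ∘ Fin.suc) 0<b (f<b ∘ Fin.suc) r

toℕ-mod : ∀ {t} .{{_ : NonZero t}} (i : Fin t) → toℕ i mod t ≡ i
toℕ-mod i = toℕ-injective (trans (toℕ-fromℕ< _) (m<n⇒m%n≡m (toℕ<n i)))

remQuot-injective : ∀ {m} n {i j : Fin (m * n)} → remQuot {m} n i ≡ remQuot n j → i ≡ j
remQuot-injective {m} n {i} {j} eq = begin
  i                                 ≡⟨ combine-remQuot {m} n i ⟨
  uncurry combine (remQuot {m} n i) ≡⟨ cong (uncurry combine) eq ⟩
  uncurry combine (remQuot {m} n j) ≡⟨ combine-remQuot {m} n j ⟩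
  j                                 ∎

funToFin-cong : ∀ {m n} {f g : Fin m → Fin n} → (∀ i → f i ≡ g i) → funToFin f ≡ funToFin g
funToFin-cong {zero}  _  = refl
funToFin-cong {suc m} eq = cong₂ combine (eq Fin.zero) (funToFin-cong (eq ∘ Fin.suc))

finToFun-injective : ∀ {m n} {a b : Fin (n ^ m)} → (∀ i → finToFun {n} {m} a i ≡ finToFun b i) → a ≡ b
finToFun-injective {m} {n} {a} {b} eq = begin
  a                             ≡⟨ funToFin-finToFin {m} {n} a ⟨
  funToFin (finToFun {n} {m} a) ≡⟨ funToFin-cong eq ⟩
  funToFin (finToFun {n} {m} b) ≡⟨ funToFin-finToFin {m} {n} b ⟩
  b                             ∎

module Counting {q k ℓ u m E : ℕ} .{{_ : NonZero k}} (k≡m*t : k ≡ m * suc (suc u))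
  (us : Fin E → Word q k) (valid : Valid q k ℓ E us) where

  open Interleaving {t = suc (suc u)} {m} k≡m*t us valid public

  -- Offset 0 is below m, offsets 2, …, t-1 are free, and offset 1 makes the sum divisible by k.
  offset : Fin m → (Fin u → Fin k) → ℕ → ℕ
  offset s rest zero          = toℕ s
  offset s rest (suc zero)    = neg% (toℕ s + ∑< u (extend (toℕ ∘ rest))) k
  offset s rest (suc (suc r)) = extend (toℕ ∘ rest) r

  offset-offsets : ∀ s rest → Offsets (suc (suc u)) m k (offset s rest)
  offset-offsets s rest = record
    { offset<k   = offset<k′
    ; offset₀<m  = toℕ<n s
    ; k∣∑offsets = m%n≡0⇒n∣m _ k (begin
        (toℕ s + (neg% (toℕ s + σ) k + σ)) % k ≡⟨ cong (_% k) (x∙yz≈y∙xz (toℕ s) _ σ) ⟩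
        (neg% (toℕ s + σ) k + (toℕ s + σ)) % k ≡⟨ [neg%n+n]%d≡0 (toℕ s + σ) k ⟩
        0                                      ∎)
    }
    where
    σ = ∑< u (extend (toℕ ∘ rest))
    offset<k′ : ∀ r → r < suc (suc u) → offset s rest r < k
    offset<k′ zero          _ = <-≤-trans (toℕ<n s) (subst (m ≤_) (sym k≡m*t) (m≤m*n m _))
    offset<k′ (suc zero)    _ = m%n<n _ k
    offset<k′ (suc (suc r)) _ = extend-< (toℕ ∘ rest) (>-nonZero⁻¹ k) (toℕ<n ∘ rest) r

  patternOf : Fin (E ^ suc (suc u)) → Fin m → Fin (k ^ u) → Pattern
  patternOf A s C = record
    { word    = λ r → finToFun {E} A (r mod suc (suc u))
    ; offset  = offset s (finToFun {k} C)
    ; offsets = offset-offsets s (finToFun C)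
    }

  patternOf-injective : ∀ {A A′ s s′ C C′} → patternOf A s C ≈ patternOf A′ s′ C′ → A ≡ A′ × s ≡ s′ × C ≡ C′
  patternOf-injective {A} {A′} {s} {s′} {C} {C′} (same-words , same-offsets) =
    finToFun-injective A-agree , toℕ-injective (same-offsets 0 z<s) , finToFun-injective C-agree
    where
    A-agree : ∀ i → finToFun A i ≡ finToFun A′ i
    A-agree i = begin
      finToFun A i                        ≡⟨ cong (finToFun A) (toℕ-mod i) ⟨
      finToFun A (toℕ i mod suc (suc u))  ≡⟨ same-words (toℕ i) (toℕ<n i) ⟩
      finToFun A′ (toℕ i mod suc (suc u)) ≡⟨ cong (finToFun A′) (toℕ-mod i) ⟩
      finToFun A′ i                       ∎
    C-agree : ∀ i → finToFun C i ≡ finToFun C′ i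
    C-agree i = toℕ-injective (begin
      toℕ (finToFun C i)                  ≡⟨ extend-toℕ (toℕ ∘ finToFun C) i ⟨
      offset s (finToFun C) (2 + toℕ i)   ≡⟨ same-offsets (2 + toℕ i) (s<s (s<s (toℕ<n i))) ⟩
      offset s′ (finToFun C′) (2 + toℕ i) ≡⟨ extend-toℕ (toℕ ∘ finToFun C′) i ⟩
      toℕ (finToFun C′ i)                 ∎)

  decode : Fin (E ^ suc (suc u) * (m * k ^ u)) → Pattern
  decode i = patternOf (proj₁ AB) (proj₁ sC) (proj₂ sC)
    where
    AB = remQuot {E ^ suc (suc u)} (m * k ^ u) i
    sC = remQuot {m} (k ^ u) (proj₂ AB)

  decode-injective : ∀ i j → decode i ≈ decode j → i ≡ j
  decode-injective i j same =
    remQuot-injective (m * k ^ u) (cong₂ _,_ A≡ (remQuot-injective (k ^ u) (cong₂ _,_ s≡ C≡)))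
    where
    A≡,s≡,C≡ = patternOf-injective same
    A≡ = proj₁ A≡,s≡,C≡
    s≡ = proj₁ (proj₂ A≡,s≡,C≡)
    C≡ = proj₂ (proj₂ A≡,s≡,C≡)

  count : k ^ suc u * E ^ suc (suc u) ≡ suc (suc u) * (E ^ suc (suc u) * (m * k ^ u))
  count = trans (cong (λ x → x * k ^ u * E ^ suc (suc u)) k≡m*t) (rearrange m (suc (suc u)) (k ^ u) (E ^ suc (suc u)))
    where
    rearrange : ∀ m t K X → m * t * K * X ≡ t * (X * (m * K))
    rearrange = solve-∀

interleaved-colouring : ∀ {q k ℓ t m E} .{{_ : NonZero k}} .{{_ : NonZero t}} → k ≡ m * t →
  (us : Fin E → Word q k) → Valid q k ℓ E us →
  ∃ λ N → k ^ (t ∸ 1) * E ^ t ≡ t * N × HasValidColouring q (t * k) (t * ℓ) N {{m*n≢0 t k}}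
interleaved-colouring {t = zero} _ _ _ = contradiction refl (≢-nonZero⁻¹ 0)
interleaved-colouring {k = k} {t = 1} {m} {E} k≡m*1 us valid =
  E , cong (_+ 0) (*-identityʳ E) , colouring copy (λ j j′ (same , _) → same 0 z<s)
  where
  open Interleaving {t = 1} {m} k≡m*1 us valid
  copy : Fin E → Pattern
  copy j = record
    { word    = λ _ → j
    ; offset  = λ _ → 0
    ; offsets = record
      { offset<k   = λ _ _ → >-nonZero⁻¹ k
      ; offset₀<m  = subst (0 <_) (trans k≡m*1 (*-identityʳ m)) (>-nonZero⁻¹ k)
      ; k∣∑offsets = k ∣0
      }
    }
interleaved-colouring {t = suc (suc u)} {m} k≡m*t us valid = _ , count , colouring decode decode-injective
  where
  open Counting {u = u} {m} k≡m*t us valid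

theorem3 : (q k ℓ t : ℕ) → 1 ≤ q → 1 ≤ ℓ → .{{_ : NonZero k}} → .{{_ : NonZero t}} →
    ℓ ≤ k → t ∣ k →
    ∀ E E′ → IsEBugNumber q k ℓ E → IsEBugNumber q (t * k) (t * ℓ) E′ {{m*n≢0 t k}} →
    k ^ (t ∸ 1) * E ^ t ≤ t * E′
theorem3 q k ℓ t _ _ _ (divides m k≡m*t) E E′ ((us , valid) , _) (_ , maximal) =
  let N , count , colouring = interleaved-colouring {m = m} k≡m*t us valid in
  ≤-trans (≤-reflexive count) (*-monoʳ-≤ t (maximal N colouring))
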